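{- Every axis-parallel rectangle in the Euclidean plane whose vertices have integer coordinates has a good tessellation.
   Context: A triangle in the Euclidean plane is good if it is right-angled, its vertices have integer coordinates, and its hypotenuse has gradient $-1$ (so it is isosceles with legs parallel to the axes). A tessellation of a finite region into triangles is a finite collection of triangles whose union is the region and whose interiors are pairwise disjoint. A tessellation into good triangles is good if no point is a vertex of more than $3$ of the triangles.
   Formalization: Stated over ℚ² instead of the Euclidean plane, for the rectangle, the triangles and their interiors alike. -}

module Defs where

open import Data.Integer as ℤ using (ℤ)
open import Data.Rational as ℚ using (ℚ; 0ℚ; 1ℚ; _/_)
open import Data.Nat using (ℕ)
open import Data.Fin using (Fin)
open import Data.List using (List; length; lookup)
open import Data.List.Relation.Unary.All using (All)
open import Data.Product using (Σ; ∃; _×_; _,_; proj₁; proj₂)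
open import Data.Sum using (_⊎_)
open import Relation.Binary.PropositionalEquality using (_≡_; _≢_)
open import Relation.Nullary using (¬_)
open import Function.Definitions using (Injective)

Point : Set
Point = ℤ × ℤ

QPoint : Set
QPoint = ℚ × ℚ

ι : ℤ → ℚ
ι z = z / 1

Triangle : Set
Triangle = Point × Point × Point

vA vB vC : Triangle → Point
vA (a , b , c) = a
vB (a , b , c) = b
vC (a , b , c) = c

px py : Point → ℤ
px = proj₁
py = proj₂

-- Good triangle, with the vertices listed as (right-angle vertex A, B, C),
-- BC the hypotenuse:
--  * right-angled at A (non-degenerate, dot product of legs zero),
--  * legs parallel to the axes (AB horizontal, AC vertical),
--  * hypotenuse BC has gradient -1.
IsGood : Triangle → Set
IsGood (a , b , c) =
  (b ≢ a) × (c ≢ a)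
  × ((px b ℤ.- px a) ℤ.* (px c ℤ.- px a) ℤ.+ (py b ℤ.- py a) ℤ.* (py c ℤ.- py a) ≡ ℤ.0ℤ)
  × (py b ≡ py a) × (px c ≡ px a)
  × (px c ≢ px b) × (py c ℤ.- py b ≡ ℤ.- (px c ℤ.- px b))

combo : Triangle → ℚ → ℚ → ℚ → QPoint
combo (a , b , c) l₁ l₂ l₃ =
  ( l₁ ℚ.* ι (px a) ℚ.+ l₂ ℚ.* ι (px b) ℚ.+ l₃ ℚ.* ι (px c)
  , l₁ ℚ.* ι (py a) ℚ.+ l₂ ℚ.* ι (py b) ℚ.+ l₃ ℚ.* ι (py c) )

InTriangle : QPoint → Triangle → Set
InTriangle p t = Σ ℚ λ l₁ → Σ ℚ λ l₂ → Σ ℚ λ l₃ →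
  (0ℚ ℚ.≤ l₁) × (0ℚ ℚ.≤ l₂) × (0ℚ ℚ.≤ l₃) × (l₁ ℚ.+ l₂ ℚ.+ l₃ ≡ 1ℚ)
  × (combo t l₁ l₂ l₃ ≡ p)

InInterior : QPoint → Triangle → Set
InInterior p t = Σ ℚ λ l₁ → Σ ℚ λ l₂ → Σ ℚ λ l₃ →
  (0ℚ ℚ.< l₁) × (0ℚ ℚ.< l₂) × (0ℚ ℚ.< l₃) × (l₁ ℚ.+ l₂ ℚ.+ l₃ ≡ 1ℚ)
  × (combo t l₁ l₂ l₃ ≡ p)

IsVertexOf : Point → Triangle → Set
IsVertexOf v (a , b , c) = (v ≡ a) ⊎ (v ≡ b) ⊎ (v ≡ c)

InRect : ℤ → ℤ → ℤ → ℤ → QPoint → Set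
InRect x₁ x₂ y₁ y₂ (p , q) =
  (ι x₁ ℚ.≤ p) × (p ℚ.≤ ι x₂) × (ι y₁ ℚ.≤ q) × (q ℚ.≤ ι y₂)

IsTessellation : (QPoint → Set) → List Triangle → Set
IsTessellation R ts =
  (∀ p → R p → Σ (Fin (length ts)) λ i → InTriangle p (lookup ts i))
  × (∀ p (i : Fin (length ts)) → InTriangle p (lookup ts i) → R p)
  × (∀ (i j : Fin (length ts)) → i ≢ j → ∀ p →
       ¬ (InInterior p (lookup ts i) × InInterior p (lookup ts j)))

AtMost3AtEachVertex : List Triangle → Set
AtMost3AtEachVertex ts = ∀ (v : Point) →
  ¬ (Σ (Fin 4 → Fin (length ts)) λ f →
       Injective _≡_ _≡_ f × (∀ k → IsVertexOf v (lookup ts (f k))))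

IsGoodTessellation : (QPoint → Set) → List Triangle → Set
IsGoodTessellation R ts =
  All IsGood ts × IsTessellation R ts × AtMost3AtEachVertex ts

-- Cut a square off the rectangle along its shorter side, halve it by its anti-diagonal into two
-- good triangles, and tile the remaining rectangle recursively: the subtractive Euclidean
-- algorithm on the side lengths. Inductively the lower-left corner of each tiled rectangle is a
-- vertex of at most one triangle, and its upper-left and lower-right corners of at most two. A
-- halved square has one triangle at its lower-left and upper-right corners and two at the other
-- two. The rest of the tiling is attached along the square's top (or right) edge, so the square's
-- corner carrying two triangles is the lower-left corner of the rest, and its upper-right corner is
-- a corner of the rest carrying at most two; hence no point is a vertex of more than three
-- triangles. The halves of the square [a, a + s] × [b, b + s] are its parts where x + y ≤ a + b + s
-- and where x + y ≥ a + b + s; this assigns points to triangles and separates their interiors.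
module Submission where

open import Defs
open import Data.Empty using (⊥-elim)
open import Data.Fin using (Fin; zero; suc)
import Data.Fin.Properties as Finₚ
open import Data.Integer as ℤ using (ℤ; _<_; +_; +<+; +≤+)
import Data.Integer.Properties as ℤₚ
open import Data.Integer.Tactic.RingSolver using (solve-∀)
open import Data.List using (List; []; _∷_; _++_; length; lookup; filter)
import Data.List.Properties as Listₚ
open import Data.List.Membership.Propositional.Properties using (∈-lookup)
open import Data.List.Relation.Unary.All as All using (All; []; _∷_)
import Data.List.Relation.Unary.All.Properties as Allₚ
open import Data.List.Relation.Unary.Any as Any using (Any; here; there)
import Data.List.Relation.Unary.Any.Properties as Anyₚ
open import Data.List.Relation.Unary.AllPairs using (AllPairs; []; _∷_)
import Data.List.Relation.Unary.AllPairs.Properties as AllPairsₚ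
open import Data.Nat as ℕ using (ℕ; zero; suc)
import Data.Nat.Properties as ℕₚ
import Data.Nat.Coprimality as Coprimality
open import Data.Product using (Σ; ∃; _×_; _,_; proj₁; proj₂)
import Data.Product.Properties as Productₚ
open import Data.Rational as ℚ using (ℚ; 0ℚ; 1ℚ; mkℚ; _+_; _*_; _-_; 1/_)
import Data.Rational.Properties as ℚₚ
open import Data.Rational.Solver using (module +-*-Solver)
open import Data.Sum as Sum using (_⊎_; inj₁; inj₂; [_,_]′)
open import Function using (_∘_)
open import Function.Definitions using (Injective)
open import Level using (0ℓ)
open import Relation.Binary.Definitions using (Symmetric)
open import Relation.Binary.PropositionalEquality
  using (_≡_; _≢_; refl; sym; trans; cong; cong₂; subst; subst₂; module ≡-Reasoning)
open import Relation.Nullary using (¬_; Dec; yes; no)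
open import Relation.Nullary.Decidable using (_⊎-dec_)
open import Relation.Unary using (Pred; Decidable; _∈_; _∉_; _⊆_; _∪_; _⊥_)

open +-*-Solver

coprime-1 : ∀ n → Coprimality.Coprime n 1
coprime-1 n = Coprimality.sym (Coprimality.1-coprimeTo n)

ι-mkℚ : ∀ z → ι z ≡ mkℚ z 0 (coprime-1 ℤ.∣ z ∣)
ι-mkℚ (+ n)      = ℚₚ.normalize-coprime (coprime-1 n)
ι-mkℚ ℤ.-[1+ n ] = cong ℚ.-_ (ℚₚ.normalize-coprime (coprime-1 (suc n)))

ι-+ : ∀ m n → ι (m ℤ.+ n) ≡ ι m + ι n
ι-+ m n rewrite ι-mkℚ m | ι-mkℚ n =
  cong ι (cong₂ ℤ._+_ (sym (ℤₚ.*-identityʳ m)) (sym (ℤₚ.*-identityʳ n)))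

ι-mono-≤ : ∀ {m n} → m ℤ.≤ n → ι m ℚ.≤ ι n
ι-mono-≤ {m} {n} m≤n rewrite ι-mkℚ m | ι-mkℚ n =
  ℚ.*≤* (subst₂ ℤ._≤_ (sym (ℤₚ.*-identityʳ m)) (sym (ℤₚ.*-identityʳ n)) m≤n)

ι-mono-< : ∀ {m n} → m ℤ.< n → ι m ℚ.< ι n
ι-mono-< {m} {n} m<n rewrite ι-mkℚ m | ι-mkℚ n =
  ℚ.*<* (subst₂ ℤ._<_ (sym (ℤₚ.*-identityʳ m)) (sym (ℤₚ.*-identityʳ n)) m<n)

ι-nonNeg : ∀ n → 0ℚ ℚ.≤ ι (+ n)
ι-nonNeg n = ι-mono-≤ {+ 0} {+ n} (+≤+ ℕ.z≤n)

ι-pos : ∀ {n} → 0 ℕ.< n → 0ℚ ℚ.< ι (+ n)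
ι-pos {n} 0<n = ι-mono-< {+ 0} {+ n} (+<+ 0<n)

toQPoint : Point → QPoint
toQPoint (x , y) = ι x , ι y

p≤p+q : ∀ {p q} → 0ℚ ℚ.≤ q → p ℚ.≤ p + q
p≤p+q {p} {q} 0≤q = subst (ℚ._≤ p + q) (ℚₚ.+-identityʳ p) (ℚₚ.+-monoʳ-≤ p 0≤q)

p<p+q : ∀ {p q} → 0ℚ ℚ.< q → p ℚ.< p + q
p<p+q {p} {q} 0<q = subst (ℚ._< p + q) (ℚₚ.+-identityʳ p) (ℚₚ.+-monoʳ-< p 0<q)

p≤q⇒0≤q-p : ∀ {p q} → p ℚ.≤ q → 0ℚ ℚ.≤ q - p
p≤q⇒0≤q-p {p} {q} p≤q = subst (ℚ._≤ q - p) (ℚₚ.+-inverseʳ p) (ℚₚ.+-monoˡ-≤ (ℚ.- p) p≤q)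

*-nonNeg : ∀ {p q} → 0ℚ ℚ.≤ p → 0ℚ ℚ.≤ q → 0ℚ ℚ.≤ p * q
*-nonNeg {p} {q} 0≤p 0≤q =
  subst (ℚ._≤ p * q) (ℚₚ.*-zeroˡ q) (ℚₚ.*-monoʳ-≤-nonNeg q {{ℚ.nonNegative 0≤q}} 0≤p)

*-pos : ∀ {p q} → 0ℚ ℚ.< p → 0ℚ ℚ.< q → 0ℚ ℚ.< p * q
*-pos {p} {q} 0<p 0<q =
  subst (ℚ._< p * q) (ℚₚ.*-zeroˡ q) (ℚₚ.*-monoˡ-<-pos q {{ℚ.positive 0<q}} 0<p)

offset-< : ∀ a {s} → 0 ℕ.< s → a ℤ.< a ℤ.+ + s
offset-< a {s} 0<s = subst (ℤ._< a ℤ.+ + s) (ℤₚ.+-identityʳ a) (ℤₚ.+-monoʳ-< a (+<+ 0<s))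

offset-≢ : ∀ {a s} → 0 ℕ.< s → a ℤ.+ + s ≢ a
offset-≢ {a} 0<s = ℤₚ.<⇒≢ (offset-< a 0<s) ∘ sym

offset-assoc : ∀ a m n → a ℤ.+ + m ℤ.+ + n ≡ a ℤ.+ + (m ℕ.+ n)
offset-assoc a m n = ℤₚ.+-assoc a (+ m) (+ n)

-- Records rather than Σ-types, so that the bounds can be inferred from the type.
record Interval (a : ℤ) (w : ℕ) (x : ℚ) : Set where
  constructor _,_
  field
    lower : ι a ℚ.≤ x
    upper : x ℚ.≤ ι (a ℤ.+ + w)

record OpenInterval (a : ℤ) (w : ℕ) (x : ℚ) : Set where
  constructor _,_
  field
    lower : ι a ℚ.< x
    upper : x ℚ.< ι (a ℤ.+ + w)

record Box (a b : ℤ) (w h : ℕ) (p : QPoint) : Set where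
  constructor _,_
  field
    horizontal : Interval a w (proj₁ p)
    vertical   : Interval b h (proj₂ p)

record OpenBox (a b : ℤ) (w h : ℕ) (p : QPoint) : Set where
  constructor _,_
  field
    horizontal : OpenInterval a w (proj₁ p)
    vertical   : OpenInterval b h (proj₂ p)

module _ (a : ℤ) (w₁ w₂ : ℕ) where

  private
    a≤mid : ι a ℚ.≤ ι (a ℤ.+ + w₁)
    a≤mid = ι-mono-≤ (ℤₚ.i≤i+j a (+ w₁))

    mid≤end : ι (a ℤ.+ + w₁) ℚ.≤ ι (a ℤ.+ + (w₁ ℕ.+ w₂))
    mid≤end = ι-mono-≤ (ℤₚ.+-monoʳ-≤ a (+≤+ (ℕₚ.m≤m+n w₁ w₂)))

    end≡ : ι (a ℤ.+ + w₁ ℤ.+ + w₂) ≡ ι (a ℤ.+ + (w₁ ℕ.+ w₂))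
    end≡ = cong ι (offset-assoc a w₁ w₂)

  Interval-split : Interval a (w₁ ℕ.+ w₂) ⊆ Interval a w₁ ∪ Interval (a ℤ.+ + w₁) w₂
  Interval-split {x} (a≤x , x≤end) with x ℚₚ.≤? ι (a ℤ.+ + w₁)
  ... | yes x≤mid = inj₁ (a≤x , x≤mid)
  ... | no  x≰mid = inj₂ (ℚₚ.<⇒≤ (ℚₚ.≰⇒> x≰mid) , subst (x ℚ.≤_) (sym end≡) x≤end)

  Interval-⊆ˡ : Interval a w₁ ⊆ Interval a (w₁ ℕ.+ w₂)
  Interval-⊆ˡ (a≤x , x≤mid) = a≤x , ℚₚ.≤-trans x≤mid mid≤end

  Interval-⊆ʳ : Interval (a ℤ.+ + w₁) w₂ ⊆ Interval a (w₁ ℕ.+ w₂)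
  Interval-⊆ʳ {x} (mid≤x , x≤end) = ℚₚ.≤-trans a≤mid mid≤x , subst (x ℚ.≤_) end≡ x≤end

  OpenInterval-⊆ˡ : OpenInterval a w₁ ⊆ OpenInterval a (w₁ ℕ.+ w₂)
  OpenInterval-⊆ˡ (a<x , x<mid) = a<x , ℚₚ.<-≤-trans x<mid mid≤end

  OpenInterval-⊆ʳ : OpenInterval (a ℤ.+ + w₁) w₂ ⊆ OpenInterval a (w₁ ℕ.+ w₂)
  OpenInterval-⊆ʳ {x} (mid<x , x<end) = ℚₚ.≤-<-trans a≤mid mid<x , subst (x ℚ.<_) end≡ x<end

  OpenInterval-disjoint : OpenInterval a w₁ ⊥ OpenInterval (a ℤ.+ + w₁) w₂
  OpenInterval-disjoint ((_ , x<mid) , (mid<x , _)) = ℚₚ.<-asym x<mid mid<x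

∉Interval-< : ∀ {a w x} → x ℤ.< a → ι x ∉ Interval a w
∉Interval-< x<a (a≤x , _) = ℚₚ.<-irrefl refl (ℚₚ.<-≤-trans (ι-mono-< x<a) a≤x)

∉Interval-> : ∀ {a w x} → a ℤ.+ + w ℤ.< x → ι x ∉ Interval a w
∉Interval-> end<x (_ , x≤end) = ℚₚ.<-irrefl refl (ℚₚ.≤-<-trans x≤end (ι-mono-< end<x))

module _ (a : ℤ) (s : ℕ) where

  private
    S : ℚ
    S = ι (+ s)

    end≡ : ∀ u v → u + v ≡ 1ℚ → ι (a ℤ.+ + s) ≡ (ι a + u * S) + v * S
    end≡ u v u+v≡1 = begin
      ι (a ℤ.+ + s)          ≡⟨ ι-+ a (+ s) ⟩
      ι a + S                ≡⟨ cong (λ t → ι a + t) (sym (ℚₚ.*-identityˡ S)) ⟩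
      ι a + 1ℚ * S           ≡⟨ cong (λ t → ι a + t * S) (sym u+v≡1) ⟩
      ι a + (u + v) * S      ≡⟨ solve 4 (λ A S u v → A :+ (u :+ v) :* S := (A :+ u :* S) :+ v :* S)
                                         refl (ι a) S u v ⟩
      (ι a + u * S) + v * S  ∎
      where open ≡-Reasoning

  offset∈Interval : ∀ {u v} → 0ℚ ℚ.≤ u → 0ℚ ℚ.≤ v → u + v ≡ 1ℚ → Interval a s (ι a + u * S)
  offset∈Interval {u} {v} 0≤u 0≤v u+v≡1 =
    p≤p+q (*-nonNeg 0≤u (ι-nonNeg s)) ,
    subst (ι a + u * S ℚ.≤_) (sym (end≡ u v u+v≡1)) (p≤p+q (*-nonNeg 0≤v (ι-nonNeg s)))

  offset∈OpenInterval : 0 ℕ.< s → ∀ {u v} → 0ℚ ℚ.< u → 0ℚ ℚ.< v → u + v ≡ 1ℚ →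
                        OpenInterval a s (ι a + u * S)
  offset∈OpenInterval 0<s {u} {v} 0<u 0<v u+v≡1 =
    p<p+q (*-pos 0<u (ι-pos 0<s)) ,
    subst (ι a + u * S ℚ.<_) (sym (end≡ u v u+v≡1)) (p<p+q (*-pos 0<v (ι-pos 0<s)))

  Interval⇒offset : 0 ℕ.< s → ∀ {x} → Interval a s x →
                    ∃ λ u → 0ℚ ℚ.≤ u × u ℚ.≤ 1ℚ × x ≡ ι a + u * S
  Interval⇒offset 0<s {x} (a≤x , x≤end) = (x - ι a) * T , 0≤u , u≤1 , x≡
    where
      instance
        S-pos : ℚ.Positive S
        S-pos = ℚ.positive (ι-pos 0<s)
        S≢0 : ℚ.NonZero S
        S≢0 = ℚₚ.pos⇒nonZero S

      T : ℚ
      T = 1/ S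

      0≤T : 0ℚ ℚ.≤ T
      0≤T = ℚₚ.<⇒≤ (ℚₚ.positive⁻¹ T {{ℚₚ.1/pos⇒pos S}})

      x-a≤S : x - ι a ℚ.≤ S
      x-a≤S = subst (x - ι a ℚ.≤_)
        (trans (cong (_- ι a) (ι-+ a (+ s))) (solve 2 (λ A S → (A :+ S) :- A := S) refl (ι a) S))
        (ℚₚ.+-monoˡ-≤ (ℚ.- ι a) x≤end)

      0≤u : 0ℚ ℚ.≤ (x - ι a) * T
      0≤u = *-nonNeg (p≤q⇒0≤q-p a≤x) 0≤T

      u≤1 : (x - ι a) * T ℚ.≤ 1ℚ
      u≤1 = subst ((x - ι a) * T ℚ.≤_) (ℚₚ.*-inverseʳ S)
              (ℚₚ.*-monoʳ-≤-nonNeg T {{ℚ.nonNegative 0≤T}} x-a≤S)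

      x≡ : x ≡ ι a + (x - ι a) * T * S
      x≡ = begin
        x                          ≡⟨ solve 2 (λ x A → x := A :+ (x :- A) :* con 1ℚ) refl x (ι a) ⟩
        ι a + (x - ι a) * 1ℚ       ≡⟨ cong (λ t → ι a + (x - ι a) * t) (sym (ℚₚ.*-inverseˡ S)) ⟩
        ι a + (x - ι a) * (T * S)  ≡⟨ solve 4 (λ x A T S → A :+ (x :- A) :* (T :* S) := A :+ (x :- A) :* T :* S)
                                              refl x (ι a) T S ⟩
        ι a + (x - ι a) * T * S    ∎
        where open ≡-Reasoning

-- The two halves of a square

hull : Triangle → Pred QPoint 0ℓ
hull t p = InTriangle p t

interior : Triangle → Pred QPoint 0ℓ
interior t p = InInterior p t

module Weights (l₁ l₂ l₃ : ℚ) (Σl : l₁ + l₂ + l₃ ≡ 1ℚ) where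

  collapse : ∀ {lhs X R} → lhs ≡ (l₁ + l₂ + l₃) * X + R → lhs ≡ X + R
  collapse {X = X} {R} eq =
    trans eq (trans (cong (λ t → t * X + R) Σl) (cong (λ t → t + R) (ℚₚ.*-identityˡ X)))

  second+rest : l₂ + (l₁ + l₃) ≡ 1ℚ
  second+rest = trans (solve 3 (λ a b c → b :+ (a :+ c) := a :+ b :+ c) refl l₁ l₂ l₃) Σl

  third+rest : l₃ + (l₁ + l₂) ≡ 1ℚ
  third+rest = trans (solve 3 (λ a b c → c :+ (a :+ b) := a :+ b :+ c) refl l₁ l₂ l₃) Σl

  rest+second : (l₁ + l₃) + l₂ ≡ 1ℚ
  rest+second = trans (solve 3 (λ a b c → (a :+ c) :+ b := a :+ b :+ c) refl l₁ l₂ l₃) Σl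

lowerHalf : ℤ → ℤ → ℕ → Triangle
lowerHalf a b s = (a , b) , (a ℤ.+ + s , b) , (a , b ℤ.+ + s)

upperHalf : ℤ → ℤ → ℕ → Triangle
upperHalf a b s = (a ℤ.+ + s , b ℤ.+ + s) , (a , b ℤ.+ + s) , (a ℤ.+ + s , b)

halvedSquare : ℤ → ℤ → ℕ → List Triangle
halvedSquare a b s = lowerHalf a b s ∷ upperHalf a b s ∷ []

private
  legs-orthogonal : ∀ x y z w → x ℤ.* (y ℤ.- y) ℤ.+ (z ℤ.- z) ℤ.* w ≡ ℤ.0ℤ
  legs-orthogonal = solve-∀

  lowerHalf-slope : ∀ a b c → (b ℤ.+ c) ℤ.- b ≡ ℤ.- (a ℤ.- (a ℤ.+ c))
  lowerHalf-slope = solve-∀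

  upperHalf-slope : ∀ a b c → b ℤ.- (b ℤ.+ c) ≡ ℤ.- ((a ℤ.+ c) ℤ.- a)
  upperHalf-slope = solve-∀

lowerHalf-good : ∀ a b {s} → 0 ℕ.< s → IsGood (lowerHalf a b s)
lowerHalf-good a b {s} 0<s =
  offset-≢ 0<s ∘ cong proj₁ , offset-≢ 0<s ∘ cong proj₂ ,
  legs-orthogonal (a ℤ.+ + s ℤ.- a) a b (b ℤ.+ + s ℤ.- b) ,
  refl , refl , offset-≢ 0<s ∘ sym , lowerHalf-slope a b (+ s)

upperHalf-good : ∀ a b {s} → 0 ℕ.< s → IsGood (upperHalf a b s)
upperHalf-good a b {s} 0<s =
  offset-≢ 0<s ∘ sym ∘ cong proj₁ , offset-≢ 0<s ∘ sym ∘ cong proj₂ ,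
  legs-orthogonal (a ℤ.- (a ℤ.+ + s)) (a ℤ.+ + s) (b ℤ.+ + s) (b ℤ.- (b ℤ.+ + s)) ,
  refl , refl , offset-≢ 0<s , upperHalf-slope a b (+ s)

private
  lowerHalf-x : ∀ l₁ l₂ l₃ A S → l₁ * A + l₂ * (A + S) + l₃ * A ≡ (l₁ + l₂ + l₃) * A + l₂ * S
  lowerHalf-x = solve 5 (λ l₁ l₂ l₃ A S →
    l₁ :* A :+ l₂ :* (A :+ S) :+ l₃ :* A := (l₁ :+ l₂ :+ l₃) :* A :+ l₂ :* S) refl

  lowerHalf-y : ∀ l₁ l₂ l₃ B S → l₁ * B + l₂ * B + l₃ * (B + S) ≡ (l₁ + l₂ + l₃) * B + l₃ * S
  lowerHalf-y = solve 5 (λ l₁ l₂ l₃ B S →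
    l₁ :* B :+ l₂ :* B :+ l₃ :* (B :+ S) := (l₁ :+ l₂ :+ l₃) :* B :+ l₃ :* S) refl

  upperHalf-x : ∀ l₁ l₂ l₃ A S →
                l₁ * (A + S) + l₂ * A + l₃ * (A + S) ≡ (l₁ + l₂ + l₃) * A + (l₁ + l₃) * S
  upperHalf-x = solve 5 (λ l₁ l₂ l₃ A S →
    l₁ :* (A :+ S) :+ l₂ :* A :+ l₃ :* (A :+ S) := (l₁ :+ l₂ :+ l₃) :* A :+ (l₁ :+ l₃) :* S) refl

  upperHalf-y : ∀ l₁ l₂ l₃ B S →
                l₁ * (B + S) + l₂ * (B + S) + l₃ * B ≡ (l₁ + l₂ + l₃) * B + (l₁ + l₂) * S
  upperHalf-y = solve 5 (λ l₁ l₂ l₃ B S →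
    l₁ :* (B :+ S) :+ l₂ :* (B :+ S) :+ l₃ :* B := (l₁ :+ l₂ :+ l₃) :* B :+ (l₁ :+ l₂) :* S) refl

module _ (a b : ℤ) (s : ℕ) where

  private
    S : ℚ
    S = ι (+ s)

  lowerHalf-combo : ∀ l₁ l₂ l₃ → l₁ + l₂ + l₃ ≡ 1ℚ →
                    combo (lowerHalf a b s) l₁ l₂ l₃ ≡ (ι a + l₂ * S , ι b + l₃ * S)
  lowerHalf-combo l₁ l₂ l₃ Σl = cong₂ _,_
    (collapse (trans (cong (λ t → l₁ * ι a + l₂ * t + l₃ * ι a) (ι-+ a (+ s)))
                     (lowerHalf-x l₁ l₂ l₃ (ι a) S)))
    (collapse (trans (cong (λ t → l₁ * ι b + l₂ * ι b + l₃ * t) (ι-+ b (+ s)))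
                     (lowerHalf-y l₁ l₂ l₃ (ι b) S)))
    where open Weights l₁ l₂ l₃ Σl

  upperHalf-combo : ∀ l₁ l₂ l₃ → l₁ + l₂ + l₃ ≡ 1ℚ →
                    combo (upperHalf a b s) l₁ l₂ l₃ ≡ (ι a + (l₁ + l₃) * S , ι b + (l₁ + l₂) * S)
  upperHalf-combo l₁ l₂ l₃ Σl = cong₂ _,_
    (collapse (trans (cong (λ t → l₁ * t + l₂ * ι a + l₃ * t) (ι-+ a (+ s)))
                     (upperHalf-x l₁ l₂ l₃ (ι a) S)))
    (collapse (trans (cong (λ t → l₁ * t + l₂ * t + l₃ * ι b) (ι-+ b (+ s)))
                     (upperHalf-y l₁ l₂ l₃ (ι b) S)))
    where open Weights l₁ l₂ l₃ Σl

  lowerHalf⊆Box : hull (lowerHalf a b s) ⊆ Box a b s s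
  lowerHalf⊆Box (l₁ , l₂ , l₃ , 0≤l₁ , 0≤l₂ , 0≤l₃ , Σl , refl) =
    subst (Box a b s s) (sym (lowerHalf-combo l₁ l₂ l₃ Σl))
      ( offset∈Interval a s 0≤l₂ (ℚₚ.+-mono-≤ 0≤l₁ 0≤l₃) second+rest
      , offset∈Interval b s 0≤l₃ (ℚₚ.+-mono-≤ 0≤l₁ 0≤l₂) third+rest )
    where open Weights l₁ l₂ l₃ Σl

  upperHalf⊆Box : hull (upperHalf a b s) ⊆ Box a b s s
  upperHalf⊆Box (l₁ , l₂ , l₃ , 0≤l₁ , 0≤l₂ , 0≤l₃ , Σl , refl) =
    subst (Box a b s s) (sym (upperHalf-combo l₁ l₂ l₃ Σl))
      ( offset∈Interval a s (ℚₚ.+-mono-≤ 0≤l₁ 0≤l₃) 0≤l₂ rest+second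
      , offset∈Interval b s (ℚₚ.+-mono-≤ 0≤l₁ 0≤l₂) 0≤l₃ Σl )
    where open Weights l₁ l₂ l₃ Σl

  lowerHalf-interior⊆OpenBox : 0 ℕ.< s → interior (lowerHalf a b s) ⊆ OpenBox a b s s
  lowerHalf-interior⊆OpenBox 0<s (l₁ , l₂ , l₃ , 0<l₁ , 0<l₂ , 0<l₃ , Σl , refl) =
    subst (OpenBox a b s s) (sym (lowerHalf-combo l₁ l₂ l₃ Σl))
      ( offset∈OpenInterval a s 0<s 0<l₂ (ℚₚ.+-mono-< 0<l₁ 0<l₃) second+rest
      , offset∈OpenInterval b s 0<s 0<l₃ (ℚₚ.+-mono-< 0<l₁ 0<l₂) third+rest )
    where open Weights l₁ l₂ l₃ Σl

  upperHalf-interior⊆OpenBox : 0 ℕ.< s → interior (upperHalf a b s) ⊆ OpenBox a b s s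
  upperHalf-interior⊆OpenBox 0<s (l₁ , l₂ , l₃ , 0<l₁ , 0<l₂ , 0<l₃ , Σl , refl) =
    subst (OpenBox a b s s) (sym (upperHalf-combo l₁ l₂ l₃ Σl))
      ( offset∈OpenInterval a s 0<s (ℚₚ.+-mono-< 0<l₁ 0<l₃) 0<l₂ rest+second
      , offset∈OpenInterval b s 0<s (ℚₚ.+-mono-< 0<l₁ 0<l₂) 0<l₃ Σl )
    where open Weights l₁ l₂ l₃ Σl

  lowerHalf-below : 0 ℕ.< s → ∀ {p} → p ∈ interior (lowerHalf a b s) →
                    proj₁ p + proj₂ p ℚ.< S + (ι a + ι b)
  lowerHalf-below 0<s (l₁ , l₂ , l₃ , 0<l₁ , _ , _ , Σl , refl) =
    subst (λ p → proj₁ p + proj₂ p ℚ.< S + (ι a + ι b)) (sym (lowerHalf-combo l₁ l₂ l₃ Σl)) below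
    where
      open Weights l₁ l₂ l₃ Σl
      level : S + (ι a + ι b) ≡ (ι a + l₂ * S) + (ι b + l₃ * S) + l₁ * S
      level = sym (collapse (solve 6 (λ l₁ l₂ l₃ A B S →
        (A :+ l₂ :* S) :+ (B :+ l₃ :* S) :+ l₁ :* S := (l₁ :+ l₂ :+ l₃) :* S :+ (A :+ B))
        refl l₁ l₂ l₃ (ι a) (ι b) S))
      below : (ι a + l₂ * S) + (ι b + l₃ * S) ℚ.< S + (ι a + ι b)
      below = subst ((ι a + l₂ * S) + (ι b + l₃ * S) ℚ.<_) (sym level) (p<p+q (*-pos 0<l₁ (ι-pos 0<s)))

  upperHalf-above : 0 ℕ.< s → ∀ {p} → p ∈ interior (upperHalf a b s) →
                    S + (ι a + ι b) ℚ.< proj₁ p + proj₂ p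
  upperHalf-above 0<s (l₁ , l₂ , l₃ , 0<l₁ , _ , _ , Σl , refl) =
    subst (λ p → S + (ι a + ι b) ℚ.< proj₁ p + proj₂ p) (sym (upperHalf-combo l₁ l₂ l₃ Σl)) above
    where
      open Weights l₁ l₂ l₃ Σl
      level : (ι a + (l₁ + l₃) * S) + (ι b + (l₁ + l₂) * S) ≡ S + (ι a + ι b) + l₁ * S
      level = trans (collapse (solve 6 (λ l₁ l₂ l₃ A B S →
        (A :+ (l₁ :+ l₃) :* S) :+ (B :+ (l₁ :+ l₂) :* S) := (l₁ :+ l₂ :+ l₃) :* S :+ ((A :+ B) :+ l₁ :* S))
        refl l₁ l₂ l₃ (ι a) (ι b) S))
        (sym (ℚₚ.+-assoc S (ι a + ι b) (l₁ * S)))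
      above : S + (ι a + ι b) ℚ.< (ι a + (l₁ + l₃) * S) + (ι b + (l₁ + l₂) * S)
      above = subst (S + (ι a + ι b) ℚ.<_) (sym level) (p<p+q (*-pos 0<l₁ (ι-pos 0<s)))

  halves-disjoint : 0 ℕ.< s → interior (lowerHalf a b s) ⊥ interior (upperHalf a b s)
  halves-disjoint 0<s (p∈lower , p∈upper) =
    ℚₚ.<-asym (lowerHalf-below 0<s p∈lower) (upperHalf-above 0<s p∈upper)

  lowerHalf-∋ : ∀ {u v} → 0ℚ ℚ.≤ u → 0ℚ ℚ.≤ v → u + v ℚ.≤ 1ℚ →
                (ι a + u * S , ι b + v * S) ∈ hull (lowerHalf a b s)
  lowerHalf-∋ {u} {v} 0≤u 0≤v u+v≤1 =
    1ℚ - (u + v) , u , v , p≤q⇒0≤q-p u+v≤1 , 0≤u , 0≤v , Σl , lowerHalf-combo (1ℚ - (u + v)) u v Σl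
    where
      Σl : 1ℚ - (u + v) + u + v ≡ 1ℚ
      Σl = solve 2 (λ u v → con 1ℚ :- (u :+ v) :+ u :+ v := con 1ℚ) refl u v

  upperHalf-∋ : ∀ {u v} → u ℚ.≤ 1ℚ → v ℚ.≤ 1ℚ → 1ℚ ℚ.≤ u + v →
                (ι a + u * S , ι b + v * S) ∈ hull (upperHalf a b s)
  upperHalf-∋ {u} {v} u≤1 v≤1 1≤u+v =
    u + v - 1ℚ , 1ℚ - u , 1ℚ - v , p≤q⇒0≤q-p 1≤u+v , p≤q⇒0≤q-p u≤1 , p≤q⇒0≤q-p v≤1 , Σl ,
    trans (upperHalf-combo (u + v - 1ℚ) (1ℚ - u) (1ℚ - v) Σl)
          (cong₂ (λ u v → ι a + u * S , ι b + v * S)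
                 (solve 2 (λ u v → u :+ v :- con 1ℚ :+ (con 1ℚ :- v) := u) refl u v)
                 (solve 2 (λ u v → u :+ v :- con 1ℚ :+ (con 1ℚ :- u) := v) refl u v))
    where
      Σl : u + v - 1ℚ + (1ℚ - u) + (1ℚ - v) ≡ 1ℚ
      Σl = solve 2 (λ u v → u :+ v :- con 1ℚ :+ (con 1ℚ :- u) :+ (con 1ℚ :- v) := con 1ℚ) refl u v

  offset∈halves : ∀ {u v} → 0ℚ ℚ.≤ u → u ℚ.≤ 1ℚ → 0ℚ ℚ.≤ v → v ℚ.≤ 1ℚ →
                  (ι a + u * S , ι b + v * S) ∈ hull (lowerHalf a b s) ∪ hull (upperHalf a b s)
  offset∈halves {u} {v} 0≤u u≤1 0≤v v≤1 with u + v ℚₚ.≤? 1ℚ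
  ... | yes u+v≤1 = inj₁ (lowerHalf-∋ 0≤u 0≤v u+v≤1)
  ... | no  u+v≰1 = inj₂ (upperHalf-∋ u≤1 v≤1 (ℚₚ.<⇒≤ (ℚₚ.≰⇒> u+v≰1)))

  Box⊆halves : 0 ℕ.< s → Box a b s s ⊆ hull (lowerHalf a b s) ∪ hull (upperHalf a b s)
  Box⊆halves 0<s (x∈ , y∈) =
    let u , 0≤u , u≤1 , x≡ = Interval⇒offset a s 0<s x∈
        v , 0≤v , v≤1 , y≡ = Interval⇒offset b s 0<s y∈
    in subst (hull (lowerHalf a b s) ∪ hull (upperHalf a b s)) (sym (cong₂ _,_ x≡ y≡))
         (offset∈halves 0≤u u≤1 0≤v v≤1)

-- O contains the interiors of the triangles, so that tessellations with disjoint O concatenate.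
record Tessellates (R O : Pred QPoint 0ℓ) (ts : List Triangle) : Set where
  field
    covers          : R ⊆ (λ p → Any (InTriangle p) ts)
    within          : All (λ t → hull t ⊆ R) ts
    interiorsWithin : All (λ t → interior t ⊆ O) ts
    disjoint        : AllPairs (λ t u → interior t ⊥ interior u) ts

open Tessellates

++-tessellates : ∀ {R R₁ R₂ O O₁ O₂ ts us} →
                 R ⊆ R₁ ∪ R₂ → R₁ ⊆ R → R₂ ⊆ R → O₁ ⊆ O → O₂ ⊆ O → O₁ ⊥ O₂ →
                 Tessellates R₁ O₁ ts → Tessellates R₂ O₂ us → Tessellates R O (ts ++ us)
++-tessellates {ts = ts} R⊆R₁∪R₂ R₁⊆R R₂⊆R O₁⊆O O₂⊆O O₁⊥O₂ T U = record
  { covers          = λ p∈R → [ (λ p∈R₁ → Anyₚ.++⁺ˡ (covers T p∈R₁))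
                              , (λ p∈R₂ → Anyₚ.++⁺ʳ ts (covers U p∈R₂)) ]′ (R⊆R₁∪R₂ p∈R)
  ; within          = Allₚ.++⁺ (All.map (λ t⊆R₁ {p} p∈t → R₁⊆R (t⊆R₁ p∈t)) (within T))
                               (All.map (λ t⊆R₂ {p} p∈t → R₂⊆R (t⊆R₂ p∈t)) (within U))
  ; interiorsWithin = Allₚ.++⁺ (All.map (λ t⊆O₁ {p} p∈t → O₁⊆O (t⊆O₁ p∈t)) (interiorsWithin T))
                               (All.map (λ t⊆O₂ {p} p∈t → O₂⊆O (t⊆O₂ p∈t)) (interiorsWithin U))
  ; disjoint        = AllPairsₚ.++⁺ (disjoint T) (disjoint U)
      (All.map (λ t⊆O₁ → All.map (λ u⊆O₂ {p} (p∈t , p∈u) → O₁⊥O₂ (t⊆O₁ p∈t , u⊆O₂ p∈u))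
                                 (interiorsWithin U))
               (interiorsWithin T))
  }

AllPairs-lookup : ∀ {a ℓ} {A : Set a} {R : A → A → Set ℓ} → Symmetric R →
                  ∀ {xs} → AllPairs R xs → ∀ {i j} → i ≢ j → R (lookup xs i) (lookup xs j)
AllPairs-lookup R-sym (_ ∷ _)   {zero}  {zero}  i≢j = ⊥-elim (i≢j refl)
AllPairs-lookup R-sym (Rx ∷ _)  {zero}  {suc j} _   = All.lookup Rx (∈-lookup j)
AllPairs-lookup R-sym (Rx ∷ _)  {suc i} {zero}  _   = R-sym (All.lookup Rx (∈-lookup i))
AllPairs-lookup R-sym (_ ∷ Rxs) {suc i} {suc j} i≢j = AllPairs-lookup R-sym Rxs (i≢j ∘ cong suc)

Tessellates⇒IsTessellation : ∀ {R O ts} → Tessellates R O ts → IsTessellation R ts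
Tessellates⇒IsTessellation T =
  (λ p p∈R → let t∋p = covers T p∈R in Any.index t∋p , Anyₚ.lookup-index t∋p) ,
  (λ p i → All.lookup (within T) (∈-lookup i)) ,
  (λ i j i≢j p → AllPairs-lookup (λ t⊥u {q} (q∈u , q∈t) → t⊥u (q∈t , q∈u)) (disjoint T) i≢j {p})

IsTessellation-cong : ∀ {R R′ ts} → R ⊆ R′ → R′ ⊆ R → IsTessellation R ts → IsTessellation R′ ts
IsTessellation-cong R⊆R′ R′⊆R (covers , within , disjoint) =
  (λ p → covers p ∘ R′⊆R) , (λ p i → R⊆R′ ∘ within p i) , disjoint

Box-stack-up : ∀ {a b w h₁ h₂ ts us} →
               Tessellates (Box a b w h₁) (OpenBox a b w h₁) ts →
               Tessellates (Box a (b ℤ.+ + h₁) w h₂) (OpenBox a (b ℤ.+ + h₁) w h₂) us →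
               Tessellates (Box a b w (h₁ ℕ.+ h₂)) (OpenBox a b w (h₁ ℕ.+ h₂)) (ts ++ us)
Box-stack-up {b = b} {h₁ = h₁} {h₂} = ++-tessellates
  (λ (x∈ , y∈) → Sum.map (x∈ ,_) (x∈ ,_) (Interval-split b h₁ h₂ y∈))
  (λ (x∈ , y∈) → x∈ , Interval-⊆ˡ b h₁ h₂ y∈)
  (λ (x∈ , y∈) → x∈ , Interval-⊆ʳ b h₁ h₂ y∈)
  (λ (x∈ , y∈) → x∈ , OpenInterval-⊆ˡ b h₁ h₂ y∈)
  (λ (x∈ , y∈) → x∈ , OpenInterval-⊆ʳ b h₁ h₂ y∈)
  (λ ((_ , y∈₁) , (_ , y∈₂)) → OpenInterval-disjoint b h₁ h₂ (y∈₁ , y∈₂))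

Box-stack-right : ∀ {a b w₁ w₂ h ts us} →
                  Tessellates (Box a b w₁ h) (OpenBox a b w₁ h) ts →
                  Tessellates (Box (a ℤ.+ + w₁) b w₂ h) (OpenBox (a ℤ.+ + w₁) b w₂ h) us →
                  Tessellates (Box a b (w₁ ℕ.+ w₂) h) (OpenBox a b (w₁ ℕ.+ w₂) h) (ts ++ us)
Box-stack-right {a = a} {w₁ = w₁} {w₂} = ++-tessellates
  (λ (x∈ , y∈) → Sum.map (_, y∈) (_, y∈) (Interval-split a w₁ w₂ x∈))
  (λ (x∈ , y∈) → Interval-⊆ˡ a w₁ w₂ x∈ , y∈)
  (λ (x∈ , y∈) → Interval-⊆ʳ a w₁ w₂ x∈ , y∈)
  (λ (x∈ , y∈) → OpenInterval-⊆ˡ a w₁ w₂ x∈ , y∈)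
  (λ (x∈ , y∈) → OpenInterval-⊆ʳ a w₁ w₂ x∈ , y∈)
  (λ ((x∈₁ , _) , (x∈₂ , _)) → OpenInterval-disjoint a w₁ w₂ (x∈₁ , x∈₂))

halvedSquare-tessellates : ∀ a b {s} → 0 ℕ.< s →
                           Tessellates (Box a b s s) (OpenBox a b s s) (halvedSquare a b s)
halvedSquare-tessellates a b {s} 0<s = record
  { covers          = λ p∈Box → [ here , there ∘ here ]′ (Box⊆halves a b s 0<s p∈Box)
  ; within          = lowerHalf⊆Box a b s ∷ upperHalf⊆Box a b s ∷ []
  ; interiorsWithin = lowerHalf-interior⊆OpenBox a b s 0<s ∷ upperHalf-interior⊆OpenBox a b s 0<s ∷ []
  ; disjoint        = (halves-disjoint a b s 0<s ∷ []) ∷ [] ∷ []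
  }

-- Vertex degrees

module _ {a p} {A : Set a} {P : Pred A p} (P? : Decidable P) where

  filter-index : ∀ xs (i : Fin (length xs)) → P (lookup xs i) → Fin (length (filter P? xs))
  filter-index (x ∷ xs) i px with P? x
  filter-index (x ∷ xs) zero    px | yes _  = zero
  filter-index (x ∷ xs) (suc i) px | yes _  = suc (filter-index xs i px)
  filter-index (x ∷ xs) zero    px | no ¬px = ⊥-elim (¬px px)
  filter-index (x ∷ xs) (suc i) px | no _   = filter-index xs i px

  filter-index-injective : ∀ xs {i j} (pi : P (lookup xs i)) (pj : P (lookup xs j)) →
                           filter-index xs i pi ≡ filter-index xs j pj → i ≡ j
  filter-index-injective (x ∷ xs) {i} {j} pi pj eq with P? x
  filter-index-injective (x ∷ xs) {zero}  {zero}  pi pj eq | yes _ = refl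
  filter-index-injective (x ∷ xs) {suc i} {suc j} pi pj eq | yes _ =
    cong suc (filter-index-injective xs pi pj (Finₚ.suc-injective eq))
  filter-index-injective (x ∷ xs) {zero}  {suc j} pi pj () | yes _
  filter-index-injective (x ∷ xs) {suc i} {zero}  pi pj () | yes _
  filter-index-injective (x ∷ xs) {zero}  {_}     pi pj eq | no ¬px = ⊥-elim (¬px pi)
  filter-index-injective (x ∷ xs) {suc i} {zero}  pi pj eq | no ¬px = ⊥-elim (¬px pj)
  filter-index-injective (x ∷ xs) {suc i} {suc j} pi pj eq | no _ =
    cong suc (filter-index-injective xs pi pj eq)

  injection⇒≤-filter : ∀ {n} xs (f : Fin n → Fin (length xs)) → Injective _≡_ _≡_ f →
                       (∀ k → P (lookup xs (f k))) → n ℕ.≤ length (filter P? xs)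
  injection⇒≤-filter xs f f-inj P-f =
    Finₚ.injective⇒≤ (λ eq → f-inj (filter-index-injective xs (P-f _) (P-f _) eq))

_≟ₚ_ : (p q : Point) → Dec (p ≡ q)
_≟ₚ_ = Productₚ.≡-dec ℤ._≟_ ℤ._≟_

IsVertexOf? : ∀ v t → Dec (IsVertexOf v t)
IsVertexOf? v (a , b , c) = v ≟ₚ a ⊎-dec v ≟ₚ b ⊎-dec v ≟ₚ c

degree : Point → List Triangle → ℕ
degree v ts = length (filter (IsVertexOf? v) ts)

degree≤3⇒AtMost3 : ∀ {ts} → (∀ v → degree v ts ℕ.≤ 3) → AtMost3AtEachVertex ts
degree≤3⇒AtMost3 {ts} deg≤3 v (f , f-inj , v∈f) =
  ℕₚ.≤⇒≯ (deg≤3 v) (injection⇒≤-filter (IsVertexOf? v) ts f f-inj v∈f)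

degree-++ : ∀ v ts us → degree v (ts ++ us) ≡ degree v ts ℕ.+ degree v us
degree-++ v ts us =
  trans (cong length (Listₚ.filter-++ (IsVertexOf? v) ts us)) (Listₚ.length-++ (filter (IsVertexOf? v) ts))

degree-++-≤ : ∀ v ts us {m n} → degree v ts ℕ.≤ m → degree v us ℕ.≤ n → degree v (ts ++ us) ℕ.≤ m ℕ.+ n
degree-++-≤ v ts us ts≤m us≤n = ℕₚ.≤-trans (ℕₚ.≤-reflexive (degree-++ v ts us)) (ℕₚ.+-mono-≤ ts≤m us≤n)

degree-∷-nonVertex : ∀ {v t} → ¬ IsVertexOf v t → ∀ ts → degree v (t ∷ ts) ≡ degree v ts
degree-∷-nonVertex {v} v∉t ts = cong length (Listₚ.filter-reject (IsVertexOf? v) v∉t)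

degree-∷ : ∀ v t ts → degree v (t ∷ ts) ℕ.≤ suc (degree v ts)
degree-∷ v t ts with IsVertexOf? v t
... | yes v∈t = ℕₚ.≤-reflexive (cong length (Listₚ.filter-accept (IsVertexOf? v) v∈t))
... | no  v∉t = ℕₚ.≤-trans (ℕₚ.≤-reflexive (degree-∷-nonVertex v∉t ts)) (ℕₚ.n≤1+n _)

n≡0⇒n≤m : ∀ {m n} → n ≡ 0 → n ℕ.≤ m
n≡0⇒n≤m n≡0 = ℕₚ.≤-trans (ℕₚ.≤-reflexive n≡0) ℕ.z≤n

private
  first-vertex : ∀ p q r → 1ℚ * p + 0ℚ * q + 0ℚ * r ≡ p
  first-vertex = solve 3 (λ p q r → con 1ℚ :* p :+ con 0ℚ :* q :+ con 0ℚ :* r := p) refl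

  second-vertex : ∀ p q r → 0ℚ * p + 1ℚ * q + 0ℚ * r ≡ q
  second-vertex = solve 3 (λ p q r → con 0ℚ :* p :+ con 1ℚ :* q :+ con 0ℚ :* r := q) refl

  third-vertex : ∀ p q r → 0ℚ * p + 0ℚ * q + 1ℚ * r ≡ r
  third-vertex = solve 3 (λ p q r → con 0ℚ :* p :+ con 0ℚ :* q :+ con 1ℚ :* r := r) refl

  0≤1 : 0ℚ ℚ.≤ 1ℚ
  0≤1 = ι-nonNeg 1

vertex∈hull : ∀ {v t} → IsVertexOf v t → toQPoint v ∈ hull t
vertex∈hull {t = (ax , ay) , (bx , by) , (cx , cy)} (inj₁ refl) =
  1ℚ , 0ℚ , 0ℚ , 0≤1 , ℚₚ.≤-refl , ℚₚ.≤-refl , refl ,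
  cong₂ _,_ (first-vertex (ι ax) (ι bx) (ι cx)) (first-vertex (ι ay) (ι by) (ι cy))
vertex∈hull {t = (ax , ay) , (bx , by) , (cx , cy)} (inj₂ (inj₁ refl)) =
  0ℚ , 1ℚ , 0ℚ , ℚₚ.≤-refl , 0≤1 , ℚₚ.≤-refl , refl ,
  cong₂ _,_ (second-vertex (ι ax) (ι bx) (ι cx)) (second-vertex (ι ay) (ι by) (ι cy))
vertex∈hull {t = (ax , ay) , (bx , by) , (cx , cy)} (inj₂ (inj₂ refl)) =
  0ℚ , 0ℚ , 1ℚ , ℚₚ.≤-refl , ℚₚ.≤-refl , 0≤1 , refl ,
  cong₂ _,_ (third-vertex (ι ax) (ι bx) (ι cx)) (third-vertex (ι ay) (ι by) (ι cy))

degree-outside : ∀ {R O ts} → Tessellates R O ts → ∀ v → toQPoint v ∉ R → degree v ts ≡ 0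
degree-outside T v v∉R = cong length (Listₚ.filter-none (IsVertexOf? v)
  (All.map (λ t⊆R v∈t → v∉R (t⊆R (vertex∈hull v∈t))) (within T)))

module _ {a b w h O ts} (T : Tessellates (Box a b w h) O ts) where

  degree-below : ∀ {x y} → y ℤ.< b → degree (x , y) ts ≡ 0
  degree-below {x} {y} y<b = degree-outside T (x , y) (∉Interval-< y<b ∘ Box.vertical)

  degree-left : ∀ {x y} → x ℤ.< a → degree (x , y) ts ≡ 0
  degree-left {x} {y} x<a = degree-outside T (x , y) (∉Interval-< x<a ∘ Box.horizontal)

  degree-above : ∀ {x y} → b ℤ.+ + h ℤ.< y → degree (x , y) ts ≡ 0
  degree-above {x} {y} top<y = degree-outside T (x , y) (∉Interval-> top<y ∘ Box.vertical)

  degree-right : ∀ {x y} → a ℤ.+ + w ℤ.< x → degree (x , y) ts ≡ 0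
  degree-right {x} {y} right<x = degree-outside T (x , y) (∉Interval-> right<x ∘ Box.horizontal)

module _ (a b : ℤ) {s} (0<s : 0 ℕ.< s) where

  private
    a+s≢a : a ℤ.+ + s ≢ a
    a+s≢a = offset-≢ 0<s

    b+s≢b : b ℤ.+ + s ≢ b
    b+s≢b = offset-≢ 0<s

  degree-halvedSquare≤2 : ∀ v → degree v (halvedSquare a b s) ℕ.≤ 2
  degree-halvedSquare≤2 v = Listₚ.length-filter (IsVertexOf? v) (halvedSquare a b s)

  degree-halvedSquare-lowerLeft : degree (a , b) (halvedSquare a b s) ℕ.≤ 1
  degree-halvedSquare-lowerLeft =
    ℕₚ.≤-trans (degree-∷ (a , b) (lowerHalf a b s) _)
               (ℕₚ.≤-reflexive (cong suc (degree-∷-nonVertex lowerLeft∉upperHalf [])))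
    where
      lowerLeft∉upperHalf : ¬ IsVertexOf (a , b) (upperHalf a b s)
      lowerLeft∉upperHalf =
        [ a+s≢a ∘ sym ∘ cong proj₁ , [ b+s≢b ∘ sym ∘ cong proj₂ , a+s≢a ∘ sym ∘ cong proj₁ ]′ ]′

  degree-halvedSquare-upperRight : degree (a ℤ.+ + s , b ℤ.+ + s) (halvedSquare a b s) ℕ.≤ 1
  degree-halvedSquare-upperRight =
    ℕₚ.≤-trans (ℕₚ.≤-reflexive (degree-∷-nonVertex upperRight∉lowerHalf (upperHalf a b s ∷ [])))
               (degree-∷ (a ℤ.+ + s , b ℤ.+ + s) (upperHalf a b s) [])
    where
      upperRight∉lowerHalf : ¬ IsVertexOf (a ℤ.+ + s , b ℤ.+ + s) (lowerHalf a b s)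
      upperRight∉lowerHalf = [ a+s≢a ∘ cong proj₁ , [ b+s≢b ∘ cong proj₂ , a+s≢a ∘ cong proj₁ ]′ ]′

  degree-halvedSquare-nonCorner : ∀ {v} → v ≢ (a , b) → v ≢ (a ℤ.+ + s , b ℤ.+ + s) →
                                  v ≢ (a ℤ.+ + s , b) → v ≢ (a , b ℤ.+ + s) →
                                  degree v (halvedSquare a b s) ≡ 0
  degree-halvedSquare-nonCorner {v} v≢ll v≢ur v≢lr v≢ul = cong length (Listₚ.filter-none (IsVertexOf? v)
    ([ v≢ll , [ v≢lr , v≢ul ]′ ]′ ∷ [ v≢ur , [ v≢ul , v≢lr ]′ ]′ ∷ []))

  private
    -- Split off as a function of its own: abstracting v ≟ₚ (a , b) in a goal that
    -- mentions degree v would also abstract it inside the unfolded filter.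
    corner-cases : ∀ v → v ≡ (a , b) ⊎ v ≡ (a ℤ.+ + s , b ℤ.+ + s) ⊎ v ≡ (a ℤ.+ + s , b) ⊎ v ≡ (a , b ℤ.+ + s) ⊎
                         v ≢ (a , b) × v ≢ (a ℤ.+ + s , b ℤ.+ + s) × v ≢ (a ℤ.+ + s , b) × v ≢ (a , b ℤ.+ + s)
    corner-cases v with v ≟ₚ (a , b) | v ≟ₚ (a ℤ.+ + s , b ℤ.+ + s) | v ≟ₚ (a ℤ.+ + s , b) | v ≟ₚ (a , b ℤ.+ + s)
    ... | yes v≡ll | _        | _        | _        = inj₁ v≡ll
    ... | no _     | yes v≡ur | _        | _        = inj₂ (inj₁ v≡ur)
    ... | no _     | no _     | yes v≡lr | _        = inj₂ (inj₂ (inj₁ v≡lr))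
    ... | no _     | no _     | no _     | yes v≡ul = inj₂ (inj₂ (inj₂ (inj₁ v≡ul)))
    ... | no v≢ll  | no v≢ur  | no v≢lr  | no v≢ul  = inj₂ (inj₂ (inj₂ (inj₂ (v≢ll , v≢ur , v≢lr , v≢ul))))

  degree-halvedSquare-++ : ∀ {ts} → (∀ v → degree v ts ℕ.≤ 3) →
                           degree (a , b) ts ℕ.≤ 2 → degree (a ℤ.+ + s , b ℤ.+ + s) ts ℕ.≤ 2 →
                           degree (a ℤ.+ + s , b) ts ℕ.≤ 1 → degree (a , b ℤ.+ + s) ts ℕ.≤ 1 →
                           ∀ v → degree v (halvedSquare a b s ++ ts) ℕ.≤ 3
  degree-halvedSquare-++ {ts} deg≤3 ll ur lr ul v rewrite degree-++ v (halvedSquare a b s) ts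
    with corner-cases v
  ... | inj₁ refl                      = ℕₚ.+-mono-≤ degree-halvedSquare-lowerLeft ll
  ... | inj₂ (inj₁ refl)               = ℕₚ.+-mono-≤ degree-halvedSquare-upperRight ur
  ... | inj₂ (inj₂ (inj₁ refl))        = ℕₚ.+-mono-≤ (degree-halvedSquare≤2 v) lr
  ... | inj₂ (inj₂ (inj₂ (inj₁ refl))) = ℕₚ.+-mono-≤ (degree-halvedSquare≤2 v) ul
  ... | inj₂ (inj₂ (inj₂ (inj₂ (v≢ll , v≢ur , v≢lr , v≢ul)))) =
    subst (λ n → n ℕ.+ degree v ts ℕ.≤ 3) (sym (degree-halvedSquare-nonCorner v≢ll v≢ur v≢lr v≢ul)) (deg≤3 v)

-- Good tilings of boxes

record GoodTiling (a b : ℤ) (w h : ℕ) (ts : List Triangle) : Set where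
  field
    good         : All IsGood ts
    tessellates  : Tessellates (Box a b w h) (OpenBox a b w h) ts
    degree≤3     : ∀ v → degree v ts ℕ.≤ 3
    lowerLeft≤1  : degree (a , b) ts ℕ.≤ 1
    upperLeft≤2  : degree (a , b ℤ.+ + h) ts ℕ.≤ 2
    lowerRight≤2 : degree (a ℤ.+ + w , b) ts ℕ.≤ 2

open GoodTiling

halvedSquare-tiling : ∀ {a b s} → 0 ℕ.< s → GoodTiling a b s s (halvedSquare a b s)
halvedSquare-tiling {a} {b} {s} 0<s = record
  { good         = lowerHalf-good a b 0<s ∷ upperHalf-good a b 0<s ∷ []
  ; tessellates  = halvedSquare-tessellates a b 0<s
  ; degree≤3     = λ v → ℕₚ.≤-trans (degree-halvedSquare≤2 a b 0<s v) (ℕₚ.n≤1+n 2)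
  ; lowerLeft≤1  = degree-halvedSquare-lowerLeft a b 0<s
  ; upperLeft≤2  = degree-halvedSquare≤2 a b 0<s (a , b ℤ.+ + s)
  ; lowerRight≤2 = degree-halvedSquare≤2 a b 0<s (a ℤ.+ + s , b)
  }

GoodTiling-stack-up : ∀ {a b w h ts} → 0 ℕ.< w → 0 ℕ.< h → GoodTiling a (b ℤ.+ + w) w h ts →
                      GoodTiling a b w (w ℕ.+ h) (halvedSquare a b w ++ ts)
GoodTiling-stack-up {a} {b} {w} {h} {ts} 0<w 0<h T = record
  { good         = lowerHalf-good a b 0<w ∷ upperHalf-good a b 0<w ∷ good T
  ; tessellates  = Box-stack-up (halvedSquare-tessellates a b 0<w) (tessellates T)
  ; degree≤3     = degree-halvedSquare-++ a b 0<w (degree≤3 T)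
                     (n≡0⇒n≤m below-T) (lowerRight≤2 T) (n≡0⇒n≤m below-T) (lowerLeft≤1 T)
  ; lowerLeft≤1  = degree-++-≤ (a , b) (halvedSquare a b w) ts
                     (degree-halvedSquare-lowerLeft a b 0<w) (ℕₚ.≤-reflexive below-T)
  ; upperLeft≤2  = degree-++-≤ (a , b ℤ.+ + (w ℕ.+ h)) (halvedSquare a b w) ts
                     (ℕₚ.≤-reflexive above-square)
                     (subst (λ c → degree (a , c) ts ℕ.≤ 2) (offset-assoc b w h) (upperLeft≤2 T))
  ; lowerRight≤2 = degree-++-≤ (a ℤ.+ + w , b) (halvedSquare a b w) ts
                     (degree-halvedSquare≤2 a b 0<w (a ℤ.+ + w , b)) (ℕₚ.≤-reflexive below-T)
  }
  where
    below-T : ∀ {x} → degree (x , b) ts ≡ 0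
    below-T {x} = degree-below (tessellates T) {x} (offset-< b 0<w)

    above-square : degree (a , b ℤ.+ + (w ℕ.+ h)) (halvedSquare a b w) ≡ 0
    above-square = degree-above (halvedSquare-tessellates a b 0<w) {a}
      (subst (b ℤ.+ + w ℤ.<_) (offset-assoc b w h) (offset-< (b ℤ.+ + w) 0<h))

GoodTiling-stack-right : ∀ {a b w h ts} → 0 ℕ.< h → 0 ℕ.< w → GoodTiling (a ℤ.+ + h) b w h ts →
                         GoodTiling a b (h ℕ.+ w) h (halvedSquare a b h ++ ts)
GoodTiling-stack-right {a} {b} {w} {h} {ts} 0<h 0<w T = record
  { good         = lowerHalf-good a b 0<h ∷ upperHalf-good a b 0<h ∷ good T
  ; tessellates  = Box-stack-right (halvedSquare-tessellates a b 0<h) (tessellates T)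
  ; degree≤3     = degree-halvedSquare-++ a b 0<h (degree≤3 T)
                     (n≡0⇒n≤m left-of-T) (upperLeft≤2 T) (lowerLeft≤1 T) (n≡0⇒n≤m left-of-T)
  ; lowerLeft≤1  = degree-++-≤ (a , b) (halvedSquare a b h) ts
                     (degree-halvedSquare-lowerLeft a b 0<h) (ℕₚ.≤-reflexive left-of-T)
  ; upperLeft≤2  = degree-++-≤ (a , b ℤ.+ + h) (halvedSquare a b h) ts
                     (degree-halvedSquare≤2 a b 0<h (a , b ℤ.+ + h)) (ℕₚ.≤-reflexive left-of-T)
  ; lowerRight≤2 = degree-++-≤ (a ℤ.+ + (h ℕ.+ w) , b) (halvedSquare a b h) ts
                     (ℕₚ.≤-reflexive right-of-square)
                     (subst (λ c → degree (c , b) ts ℕ.≤ 2) (offset-assoc a h w) (lowerRight≤2 T))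
  }
  where
    left-of-T : ∀ {y} → degree (a , y) ts ≡ 0
    left-of-T {y} = degree-left (tessellates T) {y = y} (offset-< a 0<h)

    right-of-square : degree (a ℤ.+ + (h ℕ.+ w) , b) (halvedSquare a b h) ≡ 0
    right-of-square = degree-right (halvedSquare-tessellates a b 0<h) {y = b}
      (subst (a ℤ.+ + h ℤ.<_) (offset-assoc a h w) (offset-< (a ℤ.+ + h) 0<w))

goodTiling : ∀ k l a b → ∃ (GoodTiling a b (suc k) (suc l))
goodTiling k l = euclid (suc (k ℕ.+ l)) k l ℕₚ.≤-refl
  where
    euclid : ∀ n k l → k ℕ.+ l ℕ.< n → ∀ a b → ∃ (GoodTiling a b (suc k) (suc l))
    euclid (suc n) k l k+l<1+n a b with ℕ.compare k l
    ... | ℕ.equal _ = halvedSquare a b (suc k) , halvedSquare-tiling ℕ.z<s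
    ... | ℕ.less _ m =
      let ts , T = euclid n k m k+m<n a (b ℤ.+ + suc k)
      in halvedSquare a b (suc k) ++ ts ,
         subst (λ h → GoodTiling a b (suc k) h (halvedSquare a b (suc k) ++ ts)) (cong suc (ℕₚ.+-suc k m))
               (GoodTiling-stack-up ℕ.z<s ℕ.z<s T)
      where
        k+m<n : k ℕ.+ m ℕ.< n
        k+m<n = ℕₚ.≤-trans (ℕₚ.m≤n+m (suc (k ℕ.+ m)) k) (ℕₚ.≤-pred k+l<1+n)
    ... | ℕ.greater _ m =
      let ts , T = euclid n m l m+l<n (a ℤ.+ + suc l) b
      in halvedSquare a b (suc l) ++ ts ,
         subst (λ w → GoodTiling a b w (suc l) (halvedSquare a b (suc l) ++ ts)) (cong suc (ℕₚ.+-suc l m))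
               (GoodTiling-stack-right ℕ.z<s ℕ.z<s T)
      where
        m+l<n : m ℕ.+ l ℕ.< n
        m+l<n = ℕₚ.≤-trans (ℕₚ.≤-reflexive (cong suc (ℕₚ.+-comm m l)))
                           (ℕₚ.≤-trans (ℕₚ.m≤m+n (suc (l ℕ.+ m)) l) (ℕₚ.≤-pred k+l<1+n))

GoodTiling⇒IsGoodTessellation : ∀ {a b w h ts} → GoodTiling a b w h ts →
                                IsGoodTessellation (InRect a (a ℤ.+ + w) b (b ℤ.+ + h)) ts
GoodTiling⇒IsGoodTessellation {ts = ts} T =
  good T ,
  IsTessellation-cong {ts = ts} (λ ((a≤x , x≤) , (b≤y , y≤)) → a≤x , x≤ , b≤y , y≤)
                                (λ (a≤x , x≤ , b≤y , y≤) → (a≤x , x≤) , (b≤y , y≤))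
                                (Tessellates⇒IsTessellation (tessellates T)) ,
  degree≤3⇒AtMost3 {ts} (degree≤3 T)

private
  offset-telescope : ∀ m n → m ℤ.+ (ℤ.1ℤ ℤ.+ (n ℤ.- (ℤ.1ℤ ℤ.+ m))) ≡ n
  offset-telescope = solve-∀

<⇒offset : ∀ {m n} → m ℤ.< n → ∃ λ k → n ≡ m ℤ.+ + suc k
<⇒offset {m} {n} m<n =
  ℤ.∣ ℤ.suc m ℤ.- n ∣ ,
  trans (sym (offset-telescope m n))
        (cong (λ d → m ℤ.+ (ℤ.1ℤ ℤ.+ d)) (sym (ℤₚ.∣-∣-≤ (ℤₚ.i<j⇒suc[i]≤j m<n))))

lemma9 : (x₁ x₂ y₁ y₂ : ℤ) → x₁ < x₂ → y₁ < y₂ →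
    Σ (List Triangle) (λ ts → IsGoodTessellation (InRect x₁ x₂ y₁ y₂) ts)
lemma9 x₁ x₂ y₁ y₂ x₁<x₂ y₁<y₂ with <⇒offset x₁<x₂ | <⇒offset y₁<y₂
... | k , refl | l , refl =
  let ts , T = goodTiling k l x₁ y₁
  in ts , GoodTiling⇒IsGoodTessellation T
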